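{- Let $(c,d),(e,f)\in\mathcal{B}$ with $d$ and $f$ odd and $d\ne f$. Then $U=\{(0,0),(c,d),(e,f)\}$ is unavoidable in $\mathcal{B}$.
   Context: The bicyclic inverse semigroup is $\mathcal{B}=\{(a,b)\in\mathbb{Z}\times\mathbb{Z}\mid a\ge 0,\ a+b\ge 0\}$ with multiplication $(a,b)(c,d)=(\max\{c+d,a\}-d,\ b+d)$. A subset $U\subseteq\mathcal{B}$ is avoidable if $\mathcal{B}$ can be partitioned into two sets $A$ and $B$ such that no element of $U$ is a product $st$ of two distinct elements $s\ne t$ both in $A$ or both in $B$; otherwise $U$ is unavoidable. -}

module Defs where

open import Data.Integer using (ℤ; _+_; _-_; _*_; _≤_; _⊔_; +_; 0ℤ; 1ℤ)
open import Data.Product using (_×_; _,_; Σ; ∃)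
open import Data.Bool using (Bool)
open import Relation.Binary.PropositionalEquality using (_≡_)
open import Relation.Nullary using (¬_)
open import Data.Sum using (_⊎_)

-- Elements of ℤ × ℤ; the bicyclic inverse semigroup is the subset
-- { (a , b) | 0 ≤ a , 0 ≤ a + b }.
Elt : Set
Elt = ℤ × ℤ

InB : Elt → Set
InB (a , b) = (0ℤ ≤ a) × (0ℤ ≤ a + b)

_·_ : Elt → Elt → Elt
(a , b) · (c , d) = (((c + d) ⊔ a) - d , b + d)

Odd : ℤ → Set
Odd d = ∃ λ k → d ≡ 1ℤ + (+ 2) * k

-- A subset U (given as a predicate) is unavoidable if for every partition of
-- B into two classes (given by a colouring χ : Elt → Bool; only its values on
-- B matter) there are distinct s ≠ t in B of the same colour with s · t ∈ U.
Unavoidable : (Elt → Set) → Set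
Unavoidable U =
  (χ : Elt → Bool) →
  Σ Elt λ s → Σ Elt λ t →
    InB s × InB t × ¬ (s ≡ t) × (χ s ≡ χ t) × U (s · t)

Three : Elt → Elt → Elt → Set
Three x y z = (z ≡ (0ℤ , 0ℤ)) ⊎ (z ≡ x) ⊎ (z ≡ y)

module Submission where

-- Call u, v ∈ ℬ (u ≠ v) adjacent if u·v or v·u lies in U.
-- Any 2-colouring of ℬ makes some edge of an odd cycle monochromatic, so
-- U is unavoidable as soon as this graph contains a 5-cycle.
--
-- Write d = y + m and f = y - m with m ≥ 0 (possible after swapping the
-- two points because d - f is even).  The cycle
--   (0,m) — (c+m,y) — x — (e,y) — (m,-m) — (0,m)
-- works, where x = (c,m) if e ≤ c + m and x = (e+y,-m) otherwise: its
-- edges are witnessed by products equal to (0,0), (c,d) or (e,f).  The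
-- vertices are distinct exactly because d ≠ f, d ≠ 0 and f ≠ 0.

open import Defs
open import Data.Integer using (ℤ)
open import Data.Product using (_,_)
open import Relation.Binary.PropositionalEquality using (_≡_)
open import Relation.Nullary using (¬_)

open import Data.Nat using (suc)
open import Data.Integer using (_+_; _-_; -_; _*_; _≤_; _⊔_; +_; -[1+_]; 0ℤ; 1ℤ)
open import Data.Integer.Properties
  using (i≤j⇒i⊔j≡j; i≥j⇒i⊔j≡i; i≤j⇒0≤j-i; +-mono-≤; +-monoˡ-≤; +-comm;
         +-inverseˡ; +-inverseʳ; +-identityˡ; ≤-refl; ≤-reflexive; ≤-total)
open import Data.Integer.Tactic.RingSolver using (solve-∀)
open import Data.Product using (Σ; _×_; proj₁; proj₂)
open import Data.Sum using (_⊎_; inj₁; inj₂)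
open import Data.Bool using (Bool; true; false)
open import Relation.Binary.PropositionalEquality
  using (_≢_; refl; sym; trans; cong; subst; subst₂; module ≡-Reasoning)

MonochromaticHit : (Elt → Set) → (Elt → Bool) → Set
MonochromaticHit U χ =
  Σ Elt λ s → Σ Elt λ t →
    InB s × InB t × ¬ (s ≡ t) × (χ s ≡ χ t) × U (s · t)

Edge : (Elt → Set) → Elt → Elt → Set
Edge U u v = InB u × InB v × u ≢ v × (U (u · v) ⊎ U (v · u))

monochromaticEdge : ∀ {U} (χ : Elt → Bool) {u v} →
  Edge U u v → χ u ≡ χ v → MonochromaticHit U χ
monochromaticEdge χ {u} {v} (iu , iv , u≢v , inj₁ uv∈U) same =
  u , v , iu , iv , u≢v , same , uv∈U
monochromaticEdge χ {u} {v} (iu , iv , u≢v , inj₂ vu∈U) same =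
  v , u , iv , iu , (λ v≡u → u≢v (sym v≡u)) , sym same , vu∈U

pentagonMonochromatic : (b₀ b₁ b₂ b₃ b₄ : Bool) →
  (b₀ ≡ b₁) ⊎ (b₁ ≡ b₂) ⊎ (b₂ ≡ b₃) ⊎ (b₃ ≡ b₄) ⊎ (b₄ ≡ b₀)
pentagonMonochromatic true  true  _     _     _     = inj₁ refl
pentagonMonochromatic false false _     _     _     = inj₁ refl
pentagonMonochromatic true  false false _     _     = inj₂ (inj₁ refl)
pentagonMonochromatic false true  true  _     _     = inj₂ (inj₁ refl)
pentagonMonochromatic true  false true  true  _     = inj₂ (inj₂ (inj₁ refl))
pentagonMonochromatic false true  false false _     = inj₂ (inj₂ (inj₁ refl))
pentagonMonochromatic true  false true  false false = inj₂ (inj₂ (inj₂ (inj₁ refl)))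
pentagonMonochromatic false true  false true  true  = inj₂ (inj₂ (inj₂ (inj₁ refl)))
pentagonMonochromatic true  false true  false true  = inj₂ (inj₂ (inj₂ (inj₂ refl)))
pentagonMonochromatic false true  false true  false = inj₂ (inj₂ (inj₂ (inj₂ refl)))

fiveCycle⇒unavoidable : ∀ {U} v₀ v₁ v₂ v₃ v₄ →
  Edge U v₀ v₁ → Edge U v₁ v₂ → Edge U v₂ v₃ → Edge U v₃ v₄ → Edge U v₄ v₀ →
  Unavoidable U
fiveCycle⇒unavoidable {U} v₀ v₁ v₂ v₃ v₄ e₀₁ e₁₂ e₂₃ e₃₄ e₄₀ χ
  with pentagonMonochromatic (χ v₀) (χ v₁) (χ v₂) (χ v₃) (χ v₄)
... | inj₁ same                         = monochromaticEdge {U} χ e₀₁ same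
... | inj₂ (inj₁ same)                  = monochromaticEdge {U} χ e₁₂ same
... | inj₂ (inj₂ (inj₁ same))           = monochromaticEdge {U} χ e₂₃ same
... | inj₂ (inj₂ (inj₂ (inj₁ same)))    = monochromaticEdge {U} χ e₃₄ same
... | inj₂ (inj₂ (inj₂ (inj₂ same)))    = monochromaticEdge {U} χ e₄₀ same

three-swap : ∀ {x y} → Unavoidable (Three x y) → Unavoidable (Three y x)
three-swap h χ with h χ
... | s , t , is , it , s≢t , same , inj₁ p        = s , t , is , it , s≢t , same , inj₁ p
... | s , t , is , it , s≢t , same , inj₂ (inj₁ p) = s , t , is , it , s≢t , same , inj₂ (inj₂ p)
... | s , t , is , it , s≢t , same , inj₂ (inj₂ p) = s , t , is , it , s≢t , same , inj₂ (inj₁ p)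

[i+j]-j≡i : ∀ i j → (i + j) - j ≡ i
[i+j]-j≡i = solve-∀
[i+[j-k]]+k≡i+j : ∀ i j k → i + (j - k) + k ≡ i + j
[i+[j-k]]+k≡i+j = solve-∀
i+[j+k]≡[i+k]+j : ∀ i j k → i + (j + k) ≡ (i + k) + j
i+[j+k]≡[i+k]+j = solve-∀
i+[j-k]≡[i+j]-k : ∀ i j k → i + (j - k) ≡ (i + j) + - k
i+[j-k]≡[i+j]-k = solve-∀

·-left-low : ∀ a b c d → a ≤ c + d → (a , b) · (c , d) ≡ (c , b + d)
·-left-low a b c d a≤c+d = cong (_, b + d) (begin
  ((c + d) ⊔ a) - d ≡⟨ cong (_- d) (i≥j⇒i⊔j≡i a≤c+d) ⟩
  (c + d) - d       ≡⟨ [i+j]-j≡i c d ⟩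
  c                 ∎)
  where open ≡-Reasoning

·-left-high : ∀ a b c d → c + d ≤ a + d → (a + d , b) · (c , d) ≡ (a , b + d)
·-left-high a b c d c+d≤a+d = cong (_, b + d) (begin
  ((c + d) ⊔ (a + d)) - d ≡⟨ cong (_- d) (i≤j⇒i⊔j≡j c+d≤a+d) ⟩
  (a + d) - d             ≡⟨ [i+j]-j≡i a d ⟩
  a                       ∎)
  where open ≡-Reasoning

snd-≢ : ∀ {a b c d : ℤ} → b ≢ d → (a , b) ≢ (c , d)
snd-≢ b≢d eq = b≢d (cong proj₂ eq)

unavoidable-centred : (c e y m : ℤ) → InB (c , y + m) → InB (e , y - m) →
  0ℤ ≤ m → y + m ≢ y - m → y + m ≢ 0ℤ → y - m ≢ 0ℤ →
  Unavoidable (Three (c , y + m) (e , y - m))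
unavoidable-centred c e y m (0≤c , 0≤c+d) (0≤e , 0≤e+f) 0≤m d≢f d≢0 f≢0 =
  fiveCycle⇒unavoidable {U} p q x r s pq qx xr rs sp
  where
  U : Elt → Set
  U = Three (c , y + m) (e , y - m)
  p q r s : Elt
  p = (0ℤ , m)
  q = (c + m , y)
  r = (e , y)
  s = (m , - m)

  m≢y : m ≢ y
  m≢y m≡y = f≢0 (trans (cong (λ z → y - z) m≡y) (+-inverseʳ y))
  y≢-m : y ≢ - m
  y≢-m y≡-m = d≢0 (trans (cong (_+ m) y≡-m) (+-inverseˡ m))
  m≢0 : m ≢ 0ℤ
  m≢0 refl = d≢f refl

  e+f+m≡e+y : e + (y - m) + m ≡ e + y
  e+f+m≡e+y = [i+[j-k]]+k≡i+j e y m
  0≤e+y : 0ℤ ≤ e + y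
  0≤e+y = subst (0ℤ ≤_) e+f+m≡e+y (+-mono-≤ 0≤e+f 0≤m)
  m≤e+y : m ≤ e + y
  m≤e+y = subst₂ _≤_ (+-identityˡ m) e+f+m≡e+y (+-monoˡ-≤ m 0≤e+f)

  inB-p : InB p
  inB-p = ≤-refl , subst (0ℤ ≤_) (sym (+-identityˡ m)) 0≤m
  inB-q : InB q
  inB-q = +-mono-≤ 0≤c 0≤m , subst (0ℤ ≤_) (i+[j+k]≡[i+k]+j c y m) 0≤c+d
  inB-r : InB r
  inB-r = 0≤e , 0≤e+y
  inB-s : InB s
  inB-s = 0≤m , subst (0ℤ ≤_) (sym (+-inverseʳ m)) ≤-refl

  sp : Edge U s p
  sp = inB-s , inB-p , (λ eq → m≢0 (cong proj₁ eq)) ,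
       inj₁ (inj₁ (trans (·-left-low m (- m) 0ℤ m (≤-reflexive (sym (+-identityˡ m)))) (cong (0ℤ ,_) (+-inverseˡ m))))
  pq : Edge U p q
  pq = inB-p , inB-q , snd-≢ m≢y ,
       inj₂ (inj₂ (inj₁ (·-left-high c y 0ℤ m (+-monoˡ-≤ m 0≤c))))
  rs : Edge U r s
  rs = inB-r , inB-s , snd-≢ y≢-m ,
       inj₂ (inj₂ (inj₂ (trans (·-left-low m (- m) e y m≤e+y) (cong (e ,_) (+-comm (- m) y)))))

  middle : Σ Elt λ x → Edge U q x × Edge U x r
  middle with ≤-total e (c + m)
  ... | inj₁ e≤c+m = (c , m) , qx , xr
    where
    inB-x : InB (c , m)
    inB-x = 0≤c , +-mono-≤ 0≤c 0≤m
    qx : Edge U q (c , m)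
    qx = inB-q , inB-x , snd-≢ (λ y≡m → m≢y (sym y≡m)) ,
         inj₁ (inj₂ (inj₁ (·-left-low (c + m) y c m ≤-refl)))
    xr : Edge U (c , m) r
    xr = inB-x , inB-r , snd-≢ m≢y , inj₂ (inj₂ (inj₁ (·-left-low e y c m e≤c+m)))
  ... | inj₂ c+m≤e = (e + y , - m) , qx , xr
    where
    inB-x : InB (e + y , - m)
    inB-x = 0≤e+y , subst (0ℤ ≤_) (i+[j-k]≡[i+j]-k e y m) 0≤e+f
    hits-f : ∀ {u} → u ≡ (e , - m + y) → U u
    hits-f eq = inj₂ (inj₂ (trans eq (cong (e ,_) (+-comm (- m) y))))
    qx : Edge U q (e + y , - m)
    qx = inB-q , inB-x , snd-≢ y≢-m ,
         inj₂ (hits-f (·-left-high e (- m) (c + m) y (+-monoˡ-≤ y c+m≤e)))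
    xr : Edge U (e + y , - m) r
    xr = inB-x , inB-r , snd-≢ (λ -m≡y → y≢-m (sym -m≡y)) ,
         inj₁ (hits-f (·-left-high e (- m) e y ≤-refl))

  x : Elt
  x = proj₁ middle
  qx : Edge U q x
  qx = proj₁ (proj₂ middle)
  xr : Edge U x r
  xr = proj₂ (proj₂ middle)

odd≢0 : ∀ k → 1ℤ + + 2 * k ≢ 0ℤ
odd≢0 (+ 0)          ()
odd≢0 (+ (suc n))    ()
odd≢0 (-[1+ 0 ])     ()
odd≢0 (-[1+ suc n ]) ()

odd-above-centre : ∀ k l → 1ℤ + + 2 * k ≡ (1ℤ + k + l) + (k - l)
odd-above-centre = solve-∀
odd-below-centre : ∀ k l → 1ℤ + + 2 * l ≡ (1ℤ + k + l) - (k - l)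
odd-below-centre = solve-∀

unavoidable-odd : (c e k l : ℤ) → InB (c , 1ℤ + + 2 * k) → InB (e , 1ℤ + + 2 * l) →
  l ≤ k → 1ℤ + + 2 * k ≢ 1ℤ + + 2 * l →
  Unavoidable (Three (c , 1ℤ + + 2 * k) (e , 1ℤ + + 2 * l))
unavoidable-odd c e k l (0≤c , 0≤c+d) (0≤e , 0≤e+f) l≤k d≢f =
  subst₂ (λ d f → Unavoidable (Three (c , d) (e , f))) (sym d≡) (sym f≡)
    (unavoidable-centred c e y m
      (0≤c , subst (λ z → 0ℤ ≤ c + z) d≡ 0≤c+d) (0≤e , subst (λ z → 0ℤ ≤ e + z) f≡ 0≤e+f)
      (i≤j⇒0≤j-i l≤k)
      (λ eq → d≢f (trans d≡ (trans eq (sym f≡))))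
      (λ eq → odd≢0 k (trans d≡ eq)) (λ eq → odd≢0 l (trans f≡ eq)))
  where
  y m : ℤ
  y = 1ℤ + k + l
  m = k - l
  d≡ : 1ℤ + + 2 * k ≡ y + m
  d≡ = odd-above-centre k l
  f≡ : 1ℤ + + 2 * l ≡ y - m
  f≡ = odd-below-centre k l

mainTheorem17 : (c d e f : ℤ) → InB (c , d) → InB (e , f) →
    Odd d → Odd f → ¬ (d ≡ f) →
    Unavoidable (Three (c , d) (e , f))
mainTheorem17 c d e f cd∈ℬ ef∈ℬ (k , refl) (l , refl) d≢f with ≤-total l k
... | inj₁ l≤k = unavoidable-odd c e k l cd∈ℬ ef∈ℬ l≤k d≢f
... | inj₂ k≤l = three-swap (unavoidable-odd e c l k ef∈ℬ cd∈ℬ k≤l (λ f≡d → d≢f (sym f≡d)))
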